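{- Let $(V,\mathcal{E},\mathcal{B},k)$ be an instance of Subset-Test-$r$-Cover$(m-k)$ to which Rules 1 and 2 do not apply, in which every vertex has degree at most $kr^2$, and whose non-black edges have been colored as described below. If $G$ is a set of green edges such that $N_1[g_1]\cap N_1[g_2]=\emptyset$ for every pair of distinct $g_1,g_2\in G$, then $\mathcal{E}\setminus G$ is a test cover.
   Context: An edge $e$ of a hypergraph $(V,\mathcal{E})$ separates vertices $x,y$ if $|\{x,y\}\cap e|=1$; $\mathcal{T}\subseteq\mathcal{E}$ is a test cover if every pair of distinct vertices is separated by an edge of $\mathcal{T}$. The degree of a vertex is the number of edges containing it. An edge $e$ cuts a set $X$ if $X\cap e\ne\emptyset$ and $X\setminus e\neq\emptyset$. For $\mathcal{F}\subseteq\mathcal{E}$, $N_1(\mathcal{F})=\{e\in\mathcal{E}\setminus\mathcal{F}: \exists f\in\mathcal{F},\ f\cap e\neq\emptyset\}$, $N_1[\mathcal{F}]=N_1(\mathcal{F})\cup\mathcal{F}$, and for a single edge $g$, $N_1[g]=N_1[\{g\}]$. Subset-Test-$r$-Cover$(m-k)$: given a hypergraph $(V,\mathcal{E})$ with every edge of size at most $r$ and $\mathcal{E}$ a test cover, a subset $\mathcal{B}\subseteq\mathcal{E}$ of black edges required to be in the solution, and an integer $k$, decide whether there is a test cover $\mathcal{T}$ with $\mathcal{B}\subseteq\mathcal{T}\subseteq\mathcal{E}$ and $|\mathcal{T}|\le|\mathcal{E}|-k$. Rule 1: if $x$ is a vertex of degree $1$ and $b\in\mathcal{B}$ with $b=\{x\}$,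 delete $b$ and $x$, keep $k$. Rule 2: given $b\in\mathcal{B}$, if another edge $e$ satisfies $b\subsetneq e$, replace $e$ by $e\setminus b$; if some $b'\in\mathcal{B}$ is such that $b$ cuts $b'$ and $b'$ cuts $b$, replace $b,b'$ by black edges $b\setminus b'$, $b'\setminus b$, $b\cap b'$; keep $k$. Coloring: each non-black edge $e$ with $\mathcal{E}\setminus\{e\}$ not a test cover is colored black (added to $\mathcal{B}$, with Rules 1 and 2 reapplied); a non-black edge $e$ with $\mathcal{E}\setminus\{e\}$ a test cover is colored orange if it contains a vertex of degree $1$, and green otherwise. -}

module Defs where

open import Data.Nat using (ℕ; _≤_; _*_; _^_)
open import Data.Fin using (Fin)
open import Data.Fin.Subset using (Subset; _∈_; _∉_; _⊆_; ∣_∣; ⁅_⁆)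
open import Data.Unit using (⊤)
open import Data.Vec using (tabulate; lookup)
open import Data.Product using (Σ; ∃; _×_)
open import Data.Sum using (_⊎_)
open import Relation.Nullary using (¬_)
open import Relation.Binary.PropositionalEquality using (_≡_; _≢_)
open import Function.Definitions using (Injective)

Hypergraph : ℕ → ℕ → Set
Hypergraph n m = Fin m → Subset n

module _ {n m : ℕ} (E : Hypergraph n m) where

  Separates : Subset n → Fin n → Fin n → Set
  Separates e x y = (x ∈ e × y ∉ e) ⊎ (y ∈ e × x ∉ e)

  TestCover : (Fin m → Set) → Set
  TestCover T = ∀ (x y : Fin n) → x ≢ y → ∃ λ i → T i × Separates (E i) x y

  IsTestCover : Set
  IsTestCover = TestCover (λ _ → ⊤)

  degree : Fin n → ℕ
  degree x = ∣ tabulate (λ i → lookup (E i) x) ∣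

  Cuts : Subset n → Subset n → Set
  Cuts e X = (∃ λ x → x ∈ X × x ∈ e) × (∃ λ x → x ∈ X × x ∉ e)

  NoRule1 : Subset m → Set
  NoRule1 B = ∀ (x : Fin n) (b : Fin m) → b ∈ B → degree x ≡ 1 → E b ≢ ⁅ x ⁆

  NoRule2 : Subset m → Set
  NoRule2 B =
    (∀ (b e : Fin m) → b ∈ B → e ≢ b → ¬ (E b ⊆ E e × E b ≢ E e)) ×
    (∀ (b b' : Fin m) → b ∈ B → b' ∈ B → ¬ (Cuts (E b) (E b') × Cuts (E b') (E b)))

  InN₁ : Fin m → Fin m → Set
  InN₁ g e = e ≡ g ⊎ (e ≢ g × ∃ λ v → v ∈ E e × v ∈ E g)

  Removable : Fin m → Set
  Removable e = TestCover (λ j → j ≢ e)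

  Green : Subset m → Fin m → Set
  Green B e = e ∉ B × Removable e × (∀ x → x ∈ E e → degree x ≢ 1)

  -- Hypotheses of Lemma 13: an instance (V, E, B, k) of Subset-Test-r-Cover(m-k)
  -- (edges of size ≤ r, distinct edges, E a test cover), Rules 1 and 2 do not
  -- apply, all degrees ≤ k r², and the colouring has been carried out, i.e.
  -- every non-black edge e has E \ {e} a test cover.
  record ReducedColouredInstance (r k : ℕ) (B : Subset m) : Set where
    field
      edgesDistinct : Injective _≡_ _≡_ E
      edgeSize      : ∀ i → ∣ E i ∣ ≤ r
      testCover     : IsTestCover
      noRule1       : NoRule1 B
      noRule2       : NoRule2 B
      degreeBound   : ∀ x → degree x ≤ k * r ^ 2
      coloured      : ∀ e → e ∉ B → Removable e

-- A green edge g ∈ G separating x ∈ g from y ∉ g can be dropped: since g is removable,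
-- some edge e ≠ g separates x and y. If e ∈ G, then e cannot contain x (else e lies in
-- N₁[g] ∩ N₁[e]), so y ∈ e; as x has degree ≠ 1 there is another edge f ∋ x, which lies
-- in N₁[g], hence is not in G, and f must miss y (else f ∈ N₁[g] ∩ N₁[e]), so f separates.
module Submission where

open import Defs
open import Data.Nat using (ℕ)
open import Data.Fin using (Fin; _≟_)
open import Data.Fin.Subset using (Subset; _∈_; _∉_; ⁅_⁆; ∣_∣)
open import Data.Fin.Subset.Properties using (_∈?_; x∈⁅x⁆; x∈⁅y⁆⇒x≡y; ∣⁅x⁆∣≡1)
open import Data.Fin.Properties using (any?)
open import Data.Vec using (tabulate; lookup)
open import Data.Vec.Properties using ([]=⇒lookup; lookup⇒[]=; tabulate∘lookup; tabulate-cong)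
open import Data.Bool using (true; false)
open import Data.Product using (_×_; _,_; ∃)
open import Data.Sum using (inj₁; inj₂)
open import Data.Empty using (⊥; ⊥-elim)
open import Relation.Nullary using (¬_; yes; no)
open import Relation.Nullary.Decidable using (¬?; _×-dec_)
open import Relation.Binary.PropositionalEquality

module _ {n m : ℕ} (E : Hypergraph n m) where

  Meets : Fin m → Fin m → Set
  Meets e f = ∃ λ v → v ∈ E e × v ∈ E f

  meets⇒InN₁ : ∀ {g e} → Meets e g → InN₁ E g e
  meets⇒InN₁ {g} {e} e∩g with e ≟ g
  ... | yes e≡g = inj₁ e≡g
  ... | no e≢g  = inj₂ (e≢g , e∩g)

  separates-sym : ∀ {e x y} → Separates E e x y → Separates E e y x
  separates-sym (inj₁ p) = inj₂ p
  separates-sym (inj₂ p) = inj₁ p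

  degree≡1-of-unique-edge : ∀ {x g} → x ∈ E g → (∀ f → f ≢ g → x ∉ E f) → degree E x ≡ 1
  degree≡1-of-unique-edge {x} {g} x∈g unique = begin
    ∣ tabulate (λ i → lookup (E i) x) ∣ ≡⟨ cong ∣_∣ (tabulate-cong incidence≗⁅g⁆) ⟩
    ∣ tabulate (lookup ⁅ g ⁆) ∣         ≡⟨ cong ∣_∣ (tabulate∘lookup ⁅ g ⁆) ⟩
    ∣ ⁅ g ⁆ ∣                           ≡⟨ ∣⁅x⁆∣≡1 g ⟩
    1                                   ∎
    where
    open ≡-Reasoning
    incidence≗⁅g⁆ : ∀ i → lookup (E i) x ≡ lookup ⁅ g ⁆ i
    incidence≗⁅g⁆ i with i ≟ g
    ... | yes refl = trans ([]=⇒lookup x∈g) (sym ([]=⇒lookup (x∈⁅x⁆ g)))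
    ... | no i≢g with lookup (E i) x in x∈?i | lookup ⁅ g ⁆ i in i∈?⁅g⁆
    ...   | true  | _     = ⊥-elim (unique i i≢g (lookup⇒[]= x (E i) x∈?i))
    ...   | false | false = refl
    ...   | false | true  = ⊥-elim (i≢g (x∈⁅y⁆⇒x≡y g (lookup⇒[]= i ⁅ g ⁆ i∈?⁅g⁆)))

  degree≢1⇒other-edge : ∀ {x g} → x ∈ E g → degree E x ≢ 1 → ∃ λ f → f ≢ g × x ∈ E f
  degree≢1⇒other-edge {x} {g} x∈g deg≢1 with any? (λ f → ¬? (f ≟ g) ×-dec (x ∈? E f))
  ... | yes other = other
  ... | no ¬other = ⊥-elim (deg≢1 (degree≡1-of-unique-edge x∈g
                                     (λ f f≢g x∈f → ¬other (f , f≢g , x∈f))))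

  module _ (G : Subset m)
    (disjoint : ∀ g₁ g₂ → g₁ ∈ G → g₂ ∈ G → g₁ ≢ g₂ → ∀ e → ¬ (InN₁ E g₁ e × InN₁ E g₂ e))
    where

    SeparatedOutside : Fin n → Fin n → Set
    SeparatedOutside x y = ∃ λ j → j ∉ G × Separates E (E j) x y

    no-edge-meets-two : ∀ {g₁ g₂ f} → g₁ ∈ G → g₂ ∈ G → g₁ ≢ g₂ →
                        Meets f g₁ → Meets f g₂ → ⊥
    no-edge-meets-two g₁∈G g₂∈G g₁≢g₂ f∩g₁ f∩g₂ =
      disjoint _ _ g₁∈G g₂∈G g₁≢g₂ _ (meets⇒InN₁ f∩g₁ , meets⇒InN₁ f∩g₂)

    separated-outside-one-sided :
      ∀ {g x y} → g ∈ G → Removable E g → (∀ v → v ∈ E g → degree E v ≢ 1) →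
      x ∈ E g → y ∉ E g → SeparatedOutside x y
    separated-outside-one-sided {g} {x} {y} g∈G removable deg≢1 x∈g y∉g
      with removable x y (λ { refl → y∉g x∈g })
    ... | e , e≢g , e-sep with e ∈? G
    ... | no e∉G = e , e∉G , e-sep
    ... | yes e∈G with e-sep
    ...   | inj₁ (x∈e , _) =
              ⊥-elim (no-edge-meets-two g∈G e∈G (≢-sym e≢g) (x , x∈e , x∈g) (x , x∈e , x∈e))
    ...   | inj₂ (y∈e , x∉e) with degree≢1⇒other-edge x∈g (deg≢1 x x∈g)
    ...     | f , f≢g , x∈f with y ∈? E f
    ...       | yes y∈f = ⊥-elim (no-edge-meets-two g∈G e∈G (≢-sym e≢g)
                                   (x , x∈f , x∈g) (y , y∈f , y∈e))
    ...       | no y∉f  = f , f∉G , inj₁ (x∈f , y∉f)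
      where
      f∉G : f ∉ G
      f∉G f∈G = no-edge-meets-two g∈G f∈G (≢-sym f≢g) (x , x∈f , x∈g) (x , x∈f , x∈f)

    separated-outside : ∀ {g x y} → g ∈ G → Removable E g → (∀ v → v ∈ E g → degree E v ≢ 1) →
                        Separates E (E g) x y → SeparatedOutside x y
    separated-outside g∈G removable deg≢1 (inj₁ (x∈g , y∉g)) =
      separated-outside-one-sided g∈G removable deg≢1 x∈g y∉g
    separated-outside g∈G removable deg≢1 (inj₂ (y∈g , x∉g))
      with separated-outside-one-sided g∈G removable deg≢1 y∈g x∉g
    ... | j , j∉G , j-sep = j , j∉G , separates-sym j-sep

lemma13 : ∀ {n m : ℕ} (E : Hypergraph n m) (B : Subset m) (r k : ℕ) →
    ReducedColouredInstance E r k B →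
    (G : Subset m) →
    (∀ g → g ∈ G → Green E B g) →
    (∀ g₁ g₂ → g₁ ∈ G → g₂ ∈ G → g₁ ≢ g₂ → ∀ e → ¬ (InN₁ E g₁ e × InN₁ E g₂ e)) →
    TestCover E (λ j → j ∉ G)
lemma13 E B r k reduced G green disjoint x y x≢y
  with ReducedColouredInstance.testCover reduced x y x≢y
... | i , _ , i-sep with i ∈? G
... | no i∉G = i , i∉G , i-sep
... | yes i∈G with green i i∈G
...   | _ , removable , deg≢1 = separated-outside E G disjoint i∈G removable deg≢1 i-sep
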